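{- As formal power series in $z,t$, $$\sum_{m\ge0}\sum_{k\ge0}T_{6\times m}(3,k)z^mt^k=\frac{1-z^2t-z^3t^2}{1-z-z^2t-3z^3t-2z^3t^2-z^4t^2+2z^5t^2+z^5t^3+2z^6t^3+z^6t^4}.$$
   Context: $T_{n\times m}(s,k)$ denotes the number of tilings of an $n\times m$ rectangle (width $n$, length $m$, unit grid) by exactly $k$ non-overlapping grid-aligned $s\times s$ squares and $nm-ks^2$ unit squares, with rotations/reflections counted as distinct; for $m=0$ the only tiling is the empty one with $k=0$. -}

module Defs where

open import Data.Nat using (ℕ; zero; suc; _+_; _∸_; _≤_; _<_; _≟_; _≤?_; _<?_)
open import Data.Integer using (ℤ; +_; -_) renaming (_+_ to _+ℤ_; _*_ to _*ℤ_)
open import Data.List using (List; []; _∷_; map; concatMap; filter; length; upTo; foldr)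
open import Data.List.Relation.Unary.AllPairs using (AllPairs; allPairs?)
open import Data.Product using (_×_; _,_; proj₁; proj₂)
open import Relation.Nullary using (Dec; ¬_; yes; no)
open import Relation.Nullary.Decidable using (_×-dec_; ¬?)

dist : ℕ → ℕ → ℕ
dist a b = (a ∸ b) + (b ∸ a)

-- A grid-aligned s×s square in the n×m rectangle is given by its corner
-- (i , j): it covers cells (i' , j') with i ≤ i' < i+s, j ≤ j' < j+s,
-- where 0 ≤ i' < n (width) and 0 ≤ j' < m (length).
Pos : Set
Pos = ℕ × ℕ

placements : ℕ → ℕ → ℕ → List Pos
placements n m s =
  concatMap (λ i → map (λ j → (i , j)) (upTo (suc (m ∸ s))))
            (filter (λ i → (i + s) ≤? n) (upTo (suc n)))
validPlacements : ℕ → ℕ → ℕ → List Pos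
validPlacements n m s = filter (λ p → (proj₂ p + s) ≤? m) (placements n m s)

Overlap : ℕ → Pos → Pos → Set
Overlap s (i , j) (i' , j') = (dist i i' < s) × (dist j j' < s)

overlap? : (s : ℕ) → (p q : Pos) → Dec (Overlap s p q)
overlap? s (i , j) (i' , j') = (dist i i' <? s) ×-dec (dist j j' <? s)

-- All sublists (= subsets, since the list has no duplicates).
sublists : {A : Set} → List A → List (List A)
sublists []       = [] ∷ []
sublists (x ∷ xs) = let r = sublists xs in map (x ∷_) r Data.List.++ r

-- A tiling by k s×s squares and unit squares is determined by the set of
-- its s×s squares (unit squares fill the rest), which must be k pairwise
-- non-overlapping grid-aligned s×s squares inside the rectangle.
T : ℕ → ℕ → ℕ → ℕ → ℕ
T n m s k = length (filter (λ S → (length S ≟ k) ×-dec allPairs? (λ p q → ¬? (overlap? s p q)) S)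
                           (sublists (validPlacements n m s)))

-- Bivariate formal power series over ℤ: coefficient of z^a t^b.
PS : Set
PS = ℕ → ℕ → ℤ

sumℤ : List ℤ → ℤ
sumℤ = foldr _+ℤ_ (+ 0)

_⊛_ : PS → PS → PS
(f ⊛ g) m k = sumℤ (concatMap (λ a → map (λ b → f a b *ℤ g (m ∸ a) (k ∸ b)) (upTo (suc k))) (upTo (suc m)))

F : PS
F m k = + T 6 m 3 k

Num : PS
Num 0 0 = + 1
Num 2 1 = - (+ 1)
Num 3 2 = - (+ 1)
Num _ _ = + 0

Den : PS
Den 0 0 = + 1
Den 1 0 = - (+ 1)
Den 2 1 = - (+ 1)
Den 3 1 = - (+ 3)
Den 3 2 = - (+ 2)
Den 4 2 = - (+ 1)
Den 5 2 = + 2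
Den 5 3 = + 1
Den 6 3 = + 2
Den 6 4 = + 1
Den _ _ = + 0

-- A tiling is determined by its set of pairwise disjoint 3×3 squares, so the
-- coefficients of F count independent sets in the conflict graph of the square
-- positions. Listing positions column by column, deletion–contraction on the
-- first free position gives a transfer-matrix system for the independence
-- polynomials P c of the 6 × (c + 2) strips and of the partially filled strips
-- (lanes) in which only a top or bottom row of corners is still free in the
-- first columns. Eliminating the lanes from this linear system shows that Den
-- annihilates F in every degree z^m with m ≥ 8; for m < 8 all coefficients
-- beyond t⁸ vanish and the remaining ones are computed.

module Submission where

open import Defs
open import Data.Bool using (true; false)
open import Data.Integer as ℤ using (ℤ; +_; -_; 0ℤ; 1ℤ; -1ℤ) renaming (_+_ to _+ℤ_; _*_ to _*ℤ_)
import Data.Integer.Properties as ℤ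
open import Data.Integer.Tactic.RingSolver using (solve)
open import Data.List using (List; []; _∷_; _++_; map; concat; concatMap; filter; length; applyUpTo; upTo)
open import Data.List.Properties
  using (filter-++; filter-≐; filter-none; filter-accept; filter-reject; filter-all; length-++; length-map;
         map-applyUpTo; map-cong; map-∘; map-concatMap; concat-map)
open import Data.List.Relation.Unary.All as All using (All; all?)
import Data.List.Relation.Unary.All.Properties as All
open import Data.List.Relation.Unary.AllPairs as AllPairs using (AllPairs; allPairs?)
open import Data.List.Relation.Binary.Permutation.Propositional as ↭ using (_↭_; prep; swap; ↭-reflexive)
open import Data.List.Relation.Binary.Permutation.Propositional.Properties using (filter-↭; shifts; ++⁺ˡ; map⁺)
open import Data.Nat using (ℕ; zero; suc; _+_; _∸_; _≤_; _<_; _≟_; _≤?_; _<?_; s≤s)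
open import Data.Nat.Properties
  using (suc-injective; +-commutativeSemigroup; +-comm; +-assoc; m∸n+n≡m; m+[n∸m]≡n; ≮⇒≥; +-monoˡ-≤; ≤-pred; m≤m+n)
open import Data.Nat.Tactic.RingSolver using (solve-∀)
open import Data.Product using (_×_; _,_; proj₂; map₂; uncurry)
open import Function using (_∘_; id)
open import Level using (0ℓ)
open import Relation.Binary.Definitions using (Decidable; Symmetric)
open import Relation.Binary.PropositionalEquality using (_≡_; refl; sym; trans; cong; cong₂; subst; module ≡-Reasoning)
open import Relation.Nullary using (¬_; Dec; yes; no; does; ¬?; _×-dec_)
open import Relation.Nullary.Decidable using (from-yes)
open import Relation.Unary using (Pred; _≐_) renaming (Decidable to Decidable₁)
open import Algebra.Properties.CommutativeSemigroup +-commutativeSemigroup using (x∙yz≈y∙xz; xy∙z≈xz∙y)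

open ≡-Reasoning

filter-map : {A B : Set} {P : Pred B 0ℓ} (P? : Decidable₁ P) (f : A → B) (xs : List A) →
             filter P? (map f xs) ≡ map f (filter (P? ∘ f) xs)
filter-map P? f []       = refl
filter-map P? f (x ∷ xs) with does (P? (f x))
... | true  = cong (f x ∷_) (filter-map P? f xs)
... | false = filter-map P? f xs

filter-comm : {A : Set} {P Q : Pred A 0ℓ} (P? : Decidable₁ P) (Q? : Decidable₁ Q) (xs : List A) →
              filter P? (filter Q? xs) ≡ filter Q? (filter P? xs)
filter-comm P? Q? []       = refl
filter-comm P? Q? (x ∷ xs) with does (P? x) in p | does (Q? x) in q
... | true  | true  rewrite p | q = cong (x ∷_) (filter-comm P? Q? xs)
... | true  | false rewrite q     = filter-comm P? Q? xs
... | false | true  rewrite p     = filter-comm P? Q? xs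
... | false | false               = filter-comm P? Q? xs

module IndependentSets {A : Set} {_~_ : A → A → Set} (_~?_ : Decidable _~_) where

  -- A k-set either avoids x, or contains x and k-1 elements compatible with x.
  indep : ℕ → List A → ℕ
  indep zero    _        = 1
  indep (suc k) []       = 0
  indep (suc k) (x ∷ xs) = indep k (filter (x ~?_) xs) + indep (suc k) xs

  #sublists : {P : Pred (List A) 0ℓ} → Decidable₁ P → List A → ℕ
  #sublists P? xs = length (filter P? (sublists xs))

  #sublists-∷ : {P : Pred (List A) 0ℓ} (P? : Decidable₁ P) (x : A) (xs : List A) →
                #sublists P? (x ∷ xs) ≡ #sublists (P? ∘ (x ∷_)) xs + #sublists P? xs
  #sublists-∷ P? x xs = begin
    length (filter P? (map (x ∷_) ss ++ ss))            ≡⟨ cong length (filter-++ P? (map (x ∷_) ss) ss) ⟩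
    length (filter P? (map (x ∷_) ss) ++ filter P? ss)  ≡⟨ length-++ (filter P? (map (x ∷_) ss)) ⟩
    length (filter P? (map (x ∷_) ss)) + #sublists P? xs
      ≡⟨ cong (λ ys → length ys + #sublists P? xs) (filter-map P? (x ∷_) ss) ⟩
    length (map (x ∷_) (filter (P? ∘ (x ∷_)) ss)) + #sublists P? xs
      ≡⟨ cong (_+ #sublists P? xs) (length-map (x ∷_) (filter (P? ∘ (x ∷_)) ss)) ⟩
    #sublists (P? ∘ (x ∷_)) xs + #sublists P? xs         ∎
    where ss = sublists xs

  #sublists-≐ : {P Q : Pred (List A) 0ℓ} (P? : Decidable₁ P) (Q? : Decidable₁ Q) →
                P ≐ Q → ∀ xs → #sublists P? xs ≡ #sublists Q? xs
  #sublists-≐ P? Q? P≐Q xs = cong length (filter-≐ P? Q? P≐Q (sublists xs))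

  #sublists-∅ : {P : Pred (List A) 0ℓ} (P? : Decidable₁ P) → (∀ S → ¬ P S) → ∀ xs → #sublists P? xs ≡ 0
  #sublists-∅ P? ¬P xs = cong length (filter-none P? (All.universal ¬P (sublists xs)))

  #sublists-compatible : {P : Pred (List A) 0ℓ} (P? : Decidable₁ P) (x : A) (xs : List A) →
    #sublists (λ S → P? S ×-dec all? (x ~?_) S) xs ≡ #sublists P? (filter (x ~?_) xs)
  #sublists-compatible P? x [] with P? []
  ... | yes _ = refl
  ... | no  _ = refl
  #sublists-compatible P? x (y ∷ xs) with x ~? y
  ... | yes x~y = begin
    #sublists P×x (y ∷ xs)
      ≡⟨ #sublists-∷ P×x y xs ⟩
    #sublists (P×x ∘ (y ∷_)) xs + #sublists P×x xs
      ≡⟨ cong (_+ #sublists P×x xs) (#sublists-≐ _ _ (map₂ All.tail , map₂ (x~y All.∷_)) xs) ⟩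
    #sublists (λ S → P? (y ∷ S) ×-dec all? (x ~?_) S) xs + #sublists P×x xs
      ≡⟨ cong₂ _+_ (#sublists-compatible (P? ∘ (y ∷_)) x xs) (#sublists-compatible P? x xs) ⟩
    #sublists (P? ∘ (y ∷_)) (filter (x ~?_) xs) + #sublists P? (filter (x ~?_) xs)
      ≡⟨ #sublists-∷ P? y (filter (x ~?_) xs) ⟨
    #sublists P? (y ∷ filter (x ~?_) xs) ∎
    where P×x = λ S → P? S ×-dec all? (x ~?_) S
  ... | no ¬x~y = begin
    #sublists P×x (y ∷ xs)
      ≡⟨ #sublists-∷ P×x y xs ⟩
    #sublists (P×x ∘ (y ∷_)) xs + #sublists P×x xs
      ≡⟨ cong₂ _+_ (#sublists-∅ _ (λ _ → ¬x~y ∘ All.head ∘ proj₂) xs) (#sublists-compatible P? x xs) ⟩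
    #sublists P? (filter (x ~?_) xs) ∎
    where P×x = λ S → P? S ×-dec all? (x ~?_) S

  #independent≡indep : ∀ k xs → #sublists (λ S → (length S ≟ k) ×-dec allPairs? _~?_ S) xs ≡ indep k xs
  #independent≡indep zero    []       = refl
  #independent≡indep (suc k) []       = refl
  #independent≡indep zero    (x ∷ xs) =
    trans (#sublists-∷ _ x xs) (cong₂ _+_ (#sublists-∅ _ (λ { _ (() , _) }) xs) (#independent≡indep zero xs))
  #independent≡indep (suc k) (x ∷ xs) = begin
    #sublists Indep (x ∷ xs)                            ≡⟨ #sublists-∷ Indep x xs ⟩
    #sublists (Indep ∘ (x ∷_)) xs + #sublists Indep xs
      ≡⟨ cong (_+ #sublists Indep xs) (#sublists-≐ _ _ (to , from) xs) ⟩
    #sublists (λ S → Indepₖ S ×-dec all? (x ~?_) S) xs + #sublists Indep xs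
      ≡⟨ cong (_+ #sublists Indep xs) (#sublists-compatible Indepₖ x xs) ⟩
    #sublists Indepₖ (filter (x ~?_) xs) + #sublists Indep xs
      ≡⟨ cong₂ _+_ (#independent≡indep k (filter (x ~?_) xs)) (#independent≡indep (suc k) xs) ⟩
    indep (suc k) (x ∷ xs)                              ∎
    where
      Indep  = λ S → (length S ≟ suc k) ×-dec allPairs? _~?_ S
      Indepₖ = λ S → (length S ≟ k) ×-dec allPairs? _~?_ S
      to : ∀ {S} → suc (length S) ≡ suc k × AllPairs _~_ (x ∷ S) →
           (length S ≡ k × AllPairs _~_ S) × All (x ~_) S
      to (eq , x~S AllPairs.∷ S~S) = (suc-injective eq , S~S) , x~S
      from : ∀ {S} → (length S ≡ k × AllPairs _~_ S) × All (x ~_) S →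
             suc (length S) ≡ suc k × AllPairs _~_ (x ∷ S)
      from ((eq , S~S) , x~S) = cong suc eq , x~S AllPairs.∷ S~S

  indep-map : (f : A → A) → (∀ {x y} → f x ~ f y → x ~ y) → (∀ {x y} → x ~ y → f x ~ f y) →
              ∀ k xs → indep k (map f xs) ≡ indep k xs
  indep-map f reflects preserves zero    xs       = refl
  indep-map f reflects preserves (suc k) []       = refl
  indep-map f reflects preserves (suc k) (x ∷ xs) = cong₂ _+_
    (begin
      indep k (filter (f x ~?_) (map f xs))        ≡⟨ cong (indep k) (filter-map (f x ~?_) f xs) ⟩
      indep k (map f (filter ((f x ~?_) ∘ f) xs))
        ≡⟨ cong (indep k ∘ map f) (filter-≐ _ _ (reflects , preserves) xs) ⟩
      indep k (map f (filter (x ~?_) xs))          ≡⟨ indep-map f reflects preserves k (filter (x ~?_) xs) ⟩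
      indep k (filter (x ~?_) xs)                  ∎)
    (indep-map f reflects preserves (suc k) xs)

  module _ (~-sym : Symmetric _~_) where

    indep-↭ : ∀ k {xs ys} → xs ↭ ys → indep k xs ≡ indep k ys
    indep-↭-swap : ∀ k {xs ys} x y → xs ↭ ys → Dec (x ~ y) → indep k (x ∷ y ∷ xs) ≡ indep k (y ∷ x ∷ ys)
    indep-swap : ∀ k {xs ys} x y → x ~ y → xs ↭ ys →
      indep k (y ∷ filter (x ~?_) xs) + indep k (filter (y ~?_) xs) ≡
      indep k (x ∷ filter (y ~?_) ys) + indep k (filter (x ~?_) ys)

    indep-↭ zero    _              = refl
    indep-↭ (suc k) ↭.refl         = refl
    indep-↭ (suc k) (prep x p)     = cong₂ _+_ (indep-↭ k (filter-↭ (x ~?_) p)) (indep-↭ (suc k) p)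
    indep-↭ (suc k) (↭.trans p q)  = trans (indep-↭ (suc k) p) (indep-↭ (suc k) q)
    indep-↭ (suc k) (swap x y p)   = indep-↭-swap (suc k) x y p (x ~? y)

    indep-↭-swap zero    x y p _ = refl
    indep-↭-swap (suc k) {xs} {ys} x y p (yes x~y) = begin
      indep k (filter (x ~?_) (y ∷ xs)) + (b + c)
        ≡⟨ cong (λ zs → indep k zs + (b + c)) (filter-accept (x ~?_) x~y) ⟩
      a + (b + c)     ≡⟨ +-assoc a b c ⟨
      (a + b) + c     ≡⟨ cong₂ _+_ (indep-swap k x y x~y p) (indep-↭ (suc k) p) ⟩
      (a′ + b′) + c′  ≡⟨ +-assoc a′ b′ c′ ⟩
      a′ + (b′ + c′)  ≡⟨ cong (λ zs → indep k zs + (b′ + c′)) (filter-accept (y ~?_) (~-sym x~y)) ⟨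
      indep k (filter (y ~?_) (x ∷ ys)) + (b′ + c′) ∎
      where
        a  = indep k (y ∷ filter (x ~?_) xs)
        b  = indep k (filter (y ~?_) xs)
        c  = indep (suc k) xs
        a′ = indep k (x ∷ filter (y ~?_) ys)
        b′ = indep k (filter (x ~?_) ys)
        c′ = indep (suc k) ys
    indep-↭-swap (suc k) {xs} {ys} x y p (no ¬x~y) = begin
      indep k (filter (x ~?_) (y ∷ xs)) + (b + c)
        ≡⟨ cong (λ zs → indep k zs + (b + c)) (filter-reject (x ~?_) ¬x~y) ⟩
      a + (b + c)     ≡⟨ x∙yz≈y∙xz a b c ⟩
      b + (a + c)     ≡⟨ cong₂ _+_ (indep-↭ k (filter-↭ (y ~?_) p))
                                   (cong₂ _+_ (indep-↭ k (filter-↭ (x ~?_) p)) (indep-↭ (suc k) p)) ⟩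
      b′ + (a′ + c′)  ≡⟨ cong (λ zs → indep k zs + (a′ + c′)) (filter-reject (y ~?_) (¬x~y ∘ ~-sym)) ⟨
      indep k (filter (y ~?_) (x ∷ ys)) + (a′ + c′) ∎
      where
        a  = indep k (filter (x ~?_) xs)
        b  = indep k (filter (y ~?_) xs)
        c  = indep (suc k) xs
        a′ = indep k (filter (x ~?_) ys)
        b′ = indep k (filter (y ~?_) ys)
        c′ = indep (suc k) ys

    indep-swap zero    x y x~y p = refl
    indep-swap (suc k) {xs} {ys} x y x~y p = begin
      (a + b) + c     ≡⟨ xy∙z≈xz∙y a b c ⟩
      (a + c) + b     ≡⟨ cong₂ _+_ (cong₂ _+_ a≡a′ (indep-↭ (suc k) (filter-↭ (y ~?_) p)))
                                   (indep-↭ (suc k) (filter-↭ (x ~?_) p)) ⟩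
      (a′ + c′) + b′  ∎
      where
        a  = indep k (filter (y ~?_) (filter (x ~?_) xs))
        b  = indep (suc k) (filter (x ~?_) xs)
        c  = indep (suc k) (filter (y ~?_) xs)
        a′ = indep k (filter (x ~?_) (filter (y ~?_) ys))
        b′ = indep (suc k) (filter (x ~?_) ys)
        c′ = indep (suc k) (filter (y ~?_) ys)
        a≡a′ : a ≡ a′
        a≡a′ = trans (cong (indep k) (filter-comm (y ~?_) (x ~?_) xs))
                     (indep-↭ k (filter-↭ (x ~?_) (filter-↭ (y ~?_) p)))

-- Placements of 3×3 squares

dist-comm : ∀ a b → dist a b ≡ dist b a
dist-comm a b = +-comm (a ∸ b) (b ∸ a)

Disjoint : ℕ → Pos → Pos → Set
Disjoint s p q = ¬ Overlap s p q

disjoint? : (s : ℕ) → Decidable (Disjoint s)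
disjoint? s p q = ¬? (overlap? s p q)

disjoint-sym : ∀ s → Symmetric (Disjoint s)
disjoint-sym s {i , j} {i′ , j′} p#q (i′i , j′j) =
  p#q (subst (_< s) (dist-comm i′ i) i′i , subst (_< s) (dist-comm j′ j) j′j)

T≡indep : ∀ n m s k → T n m s k ≡ IndependentSets.indep (disjoint? s) k (validPlacements n m s)
T≡indep n m s k = IndependentSets.#independent≡indep (disjoint? s) k (validPlacements n m s)

validPlacements≡placements : ∀ n m s → s ≤ m → validPlacements n m s ≡ placements n m s
validPlacements≡placements n m s s≤m =
  filter-all (λ p → (proj₂ p + s) ≤? m) (All.concat⁺ (All.map⁺ (All.universal fits is)))
  where
    is = filter (λ i → (i + s) ≤? n) (upTo (suc n))
    fits : ∀ i → All (λ p → proj₂ p + s ≤ m) (map (i ,_) (upTo (suc (m ∸ s))))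
    fits i = All.map⁺ (All.applyUpTo⁺₁ id (suc (m ∸ s)) λ j<1+m∸s →
      subst (_ ≤_) (m∸n+n≡m s≤m) (+-monoˡ-≤ s (≤-pred j<1+m∸s)))

right : Pos → Pos
right (i , j) = i , suc j

rowMajor : List ℕ → ℕ → List Pos
rowMajor is b = concatMap (λ i → map (i ,_) (upTo b)) is

columnMajor : List ℕ → ℕ → List Pos
columnMajor is zero    = []
columnMajor is (suc b) = map (_, 0) is ++ map right (columnMajor is b)

concatMap-interleave-↭ : {A B : Set} (g : A → B) (h : A → List B) (xs : List A) →
                         concatMap (λ x → g x ∷ h x) xs ↭ map g xs ++ concatMap h xs
concatMap-interleave-↭ g h []       = ↭.refl
concatMap-interleave-↭ g h (x ∷ xs) =
  prep (g x) (↭.trans (++⁺ˡ (h x) (concatMap-interleave-↭ g h xs)) (shifts (h x) (map g xs)))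

row-suc : ∀ i b → map (i ,_) (upTo (suc b)) ≡ (i , 0) ∷ map right (map (i ,_) (upTo b))
row-suc i b = cong ((i , 0) ∷_) (begin
  map (i ,_) (applyUpTo suc b)     ≡⟨ map-applyUpTo suc (i ,_) b ⟩
  applyUpTo (λ j → i , suc j) b    ≡⟨ map-applyUpTo (i ,_) right b ⟨
  map right (applyUpTo (i ,_) b)   ≡⟨ cong (map right) (map-applyUpTo id (i ,_) b) ⟨
  map right (map (i ,_) (upTo b))  ∎)

rowMajor↭columnMajor : ∀ is b → rowMajor is b ↭ columnMajor is b
rowMajor↭columnMajor []       zero    = ↭.refl
rowMajor↭columnMajor (_ ∷ is) zero    = rowMajor↭columnMajor is zero
rowMajor↭columnMajor is       (suc b) =
  ↭.trans (↭-reflexive (cong concat (map-cong (λ i → row-suc i b) is)))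
  (↭.trans (concatMap-interleave-↭ (_, 0) (λ i → map right (map (i ,_) (upTo b))) is)
  (↭.trans (↭-reflexive (cong (map (_, 0) is ++_) (sym (map-concatMap right (λ i → map (i ,_) (upTo b)) is))))
           (++⁺ˡ (map (_, 0) is) (map⁺ right (rowMajor↭columnMajor is b)))))

-- Corners of 3×3 squares in a 6 × (c + 2) rectangle, listed column by column.
columns : ℕ → List Pos
columns = columnMajor (upTo 4)

validPlacements↭columns : ∀ m → validPlacements 6 m 3 ↭ columns (m ∸ 2)
validPlacements↭columns 0                   = ↭.refl
validPlacements↭columns 1                   = ↭.refl
validPlacements↭columns 2                   = ↭.refl
validPlacements↭columns (suc (suc (suc n))) =
  ↭.trans (↭-reflexive (validPlacements≡placements 6 (3 + n) 3 (m≤m+n 3 n)))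
          (rowMajor↭columnMajor (upTo 4) (suc n))

data Edge : Set where
  top bottom : Edge

row : Edge → ℕ
row top    = 0
row bottom = 3

opposite : Edge → Edge
opposite top    = bottom
opposite bottom = top

-- Transfer-matrix states: only the row-e corners of the first r columns are free,
-- followed by c full columns.
lane : Edge → ℕ → ℕ → List Pos
lane e zero    c = columns c
lane e (suc r) c = (row e , 0) ∷ map right (lane e r c)

open IndependentSets (disjoint? 3)

right³ : List Pos → List Pos
right³ = map right ∘ map right ∘ map right

filter-far : ∀ i L → filter (disjoint? 3 (i , 0)) (right³ L) ≡ right³ L
filter-far i []      = refl
filter-far i (p ∷ L) =
  trans (filter-accept (disjoint? 3 (i , 0)) λ { (_ , s≤s (s≤s (s≤s ()))) }) (cong (_ ∷_) (filter-far i L))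

indep-right : ∀ k L → indep k (map right L) ≡ indep k L
indep-right = indep-map right id id

indep-far : ∀ i k L → indep k (filter (disjoint? 3 (i , 0)) (right³ L)) ≡ indep k L
indep-far i k L = begin
  indep k (filter (disjoint? 3 (i , 0)) (right³ L))  ≡⟨ cong (indep k) (filter-far i L) ⟩
  indep k (right³ L)                                ≡⟨ indep-right k (map right (map right L)) ⟩
  indep k (map right (map right L))                 ≡⟨ indep-right k (map right L) ⟩
  indep k (map right L)                             ≡⟨ indep-right k L ⟩
  indep k L                                         ∎

-- Each filter is computed on the explicit first columns; three columns on,
-- filter-far takes over.
columns-deletion : ∀ c k → indep (suc k) (columns (3 + c)) ≡
  indep k (lane bottom 3 c) + (indep k (columns c) + (indep k (columns c) +
  (indep k (lane top 2 c) + indep (suc k) (columns (2 + c)))))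
columns-deletion c k =
  cong₂ _+_ (cong (λ L → indep k ((3 , 0) ∷ (3 , 1) ∷ (3 , 2) ∷ L)) (filter-far 0 (columns c)))
 (cong₂ _+_ (indep-far 1 k (columns c))
 (cong₂ _+_ (indep-far 2 k (columns c))
 (cong₂ _+_ (trans (cong (λ L → indep k ((0 , 1) ∷ (0 , 2) ∷ L)) (filter-far 3 (columns c)))
                   (indep-right k (lane top 2 c)))
            (indep-right (suc k) (columns (2 + c))))))

lane₃-deletion : ∀ c k → indep (suc k) (lane bottom 3 c) ≡ indep k (columns c) + indep (suc k) (lane bottom 2 c)
lane₃-deletion c k = cong₂ _+_ (indep-far 3 k (columns c)) (indep-right (suc k) (lane bottom 2 c))

lane₂-deletion : ∀ e c k → indep (suc k) (lane e 2 (1 + c)) ≡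
  indep k (lane (opposite e) 1 c) + indep (suc k) (lane e 1 (1 + c))
lane₂-deletion top    c k = cong₂ _+_
  (trans (cong (λ L → indep k ((3 , 2) ∷ L)) (filter-far 0 (columns c)))
         (trans (indep-right k _) (indep-right k (lane bottom 1 c))))
  (indep-right (suc k) (lane top 1 (1 + c)))
lane₂-deletion bottom c k = cong₂ _+_
  (trans (cong (λ L → indep k ((0 , 2) ∷ L)) (filter-far 3 (columns c)))
         (trans (indep-right k _) (indep-right k (lane top 1 c))))
  (indep-right (suc k) (lane bottom 1 (1 + c)))

lane₁-deletion : ∀ e c k → indep (suc k) (lane e 1 (2 + c)) ≡
  indep k (lane (opposite e) 2 c) + indep (suc k) (columns (2 + c))
lane₁-deletion top    c k = cong₂ _+_
  (trans (cong (λ L → indep k ((3 , 1) ∷ (3 , 2) ∷ L)) (filter-far 0 (columns c)))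
         (indep-right k (lane bottom 2 c)))
  (indep-right (suc k) (columns (2 + c)))
lane₁-deletion bottom c k = cong₂ _+_
  (trans (cong (λ L → indep k ((0 , 1) ∷ (0 , 2) ∷ L)) (filter-far 3 (columns c)))
         (indep-right k (lane top 2 c)))
  (indep-right (suc k) (columns (2 + c)))

-- Transfer-matrix recurrences

Seq : Set
Seq = ℕ → ℤ

-- t f is the coefficient sequence of t · Σₖ f k tᵏ.
t : Seq → Seq
t f zero    = 0ℤ
t f (suc k) = f k

t^ : ℕ → Seq → Seq
t^ zero    f = f
t^ (suc j) f = t (t^ j f)

Ind : List Pos → Seq
Ind L k = + indep k L

P : ℕ → Seq
P c = Ind (columns c)

F′ : PS
F′ m = P (m ∸ 2)

F≡F′ : ∀ m k → F m k ≡ F′ m k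
F≡F′ m k = cong +_ (trans (T≡indep 6 m 3 k)
  (indep-↭ (λ {p} {q} → disjoint-sym 3 {p} {q}) k (validPlacements↭columns m)))

-- Only the sum of the two mirror-image lanes enters the recurrences.
Lanes : ℕ → ℕ → Seq
Lanes r c k = Ind (lane top r c) k +ℤ Ind (lane bottom r c) k

P-rec : ∀ j c k → t^ j (P (3 + c)) k ≡
  t^ (2 + j) (P c) k +ℤ (t^ (1 + j) (P c) k +ℤ (t^ (1 + j) (P c) k +ℤ
  (t^ (1 + j) (Lanes 2 c) k +ℤ t^ j (P (2 + c)) k)))
P-rec zero    c zero          = refl
P-rec zero    c (suc zero)    = cong +_ (columns-deletion c 0)
P-rec zero    c (suc (suc k)) = cong +_ (begin
  indep (2 + k) (columns (3 + c))                     ≡⟨ columns-deletion c (suc k) ⟩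
  indep (suc k) (lane bottom 3 c) + (b + (b + (u + r)))
    ≡⟨ cong (_+ (b + (b + (u + r)))) (lane₃-deletion c k) ⟩
  (a + l) + (b + (b + (u + r)))                       ≡⟨ regroup a l b u r ⟩
  a + (b + (b + ((u + l) + r)))                       ∎)
  where
    a = indep k (columns c)
    b = indep (suc k) (columns c)
    u = indep (suc k) (lane top 2 c)
    l = indep (suc k) (lane bottom 2 c)
    r = indep (2 + k) (columns (2 + c))
    regroup : ∀ a l b u r → (a + l) + (b + (b + (u + r))) ≡ a + (b + (b + ((u + l) + r)))
    regroup = solve-∀
P-rec (suc j) c zero          = refl
P-rec (suc j) c (suc k)       = P-rec j c k

Lanes₂-rec : ∀ j c k → t^ j (Lanes 2 (1 + c)) k ≡ t^ (1 + j) (Lanes 1 c) k +ℤ t^ j (Lanes 1 (1 + c)) k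
Lanes₂-rec zero    c zero    = refl
Lanes₂-rec zero    c (suc k) = cong +_ (begin
  indep (suc k) (lane top 2 (1 + c)) + indep (suc k) (lane bottom 2 (1 + c))
    ≡⟨ cong₂ _+_ (lane₂-deletion top c k) (lane₂-deletion bottom c k) ⟩
  (l + u′) + (u + l′)  ≡⟨ regroup l u′ u l′ ⟩
  (u + l) + (u′ + l′)  ∎)
  where
    u  = indep k (lane top 1 c)
    l  = indep k (lane bottom 1 c)
    u′ = indep (suc k) (lane top 1 (1 + c))
    l′ = indep (suc k) (lane bottom 1 (1 + c))
    regroup : ∀ l u′ u l′ → (l + u′) + (u + l′) ≡ (u + l) + (u′ + l′)
    regroup = solve-∀
Lanes₂-rec (suc j) c zero    = refl
Lanes₂-rec (suc j) c (suc k) = Lanes₂-rec j c k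

Lanes₁-rec : ∀ j c k → t^ j (Lanes 1 (2 + c)) k ≡
  t^ (1 + j) (Lanes 2 c) k +ℤ (t^ j (P (2 + c)) k +ℤ t^ j (P (2 + c)) k)
Lanes₁-rec zero    c zero    = refl
Lanes₁-rec zero    c (suc k) = cong +_ (begin
  indep (suc k) (lane top 1 (2 + c)) + indep (suc k) (lane bottom 1 (2 + c))
    ≡⟨ cong₂ _+_ (lane₁-deletion top c k) (lane₁-deletion bottom c k) ⟩
  (l + p) + (u + p)  ≡⟨ regroup l p u ⟩
  (u + l) + (p + p)  ∎)
  where
    u = indep k (lane top 2 c)
    l = indep k (lane bottom 2 c)
    p = indep (suc k) (columns (2 + c))
    regroup : ∀ l p u → (l + p) + (u + p) ≡ (u + l) + (p + p)
    regroup = solve-∀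
Lanes₁-rec (suc j) c zero    = refl
Lanes₁-rec (suc j) c (suc k) = Lanes₁-rec j c k

-- Convolution with Den

Σ< : ℕ → (ℕ → ℤ) → ℤ
Σ< n g = sumℤ (applyUpTo g n)

sumℤ-++ : ∀ xs ys → sumℤ (xs ++ ys) ≡ sumℤ xs +ℤ sumℤ ys
sumℤ-++ []       ys = sym (ℤ.+-identityˡ (sumℤ ys))
sumℤ-++ (x ∷ xs) ys = trans (cong (x +ℤ_) (sumℤ-++ xs ys)) (sym (ℤ.+-assoc x (sumℤ xs) (sumℤ ys)))

sumℤ-concat : ∀ xss → sumℤ (concat xss) ≡ sumℤ (map sumℤ xss)
sumℤ-concat []         = refl
sumℤ-concat (xs ∷ xss) = trans (sumℤ-++ xs (concat xss)) (cong (sumℤ xs +ℤ_) (sumℤ-concat xss))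

Σ<-zero : ∀ n {g} → (∀ i → g i ≡ 0ℤ) → Σ< n g ≡ 0ℤ
Σ<-zero zero    g≡0 = refl
Σ<-zero (suc n) g≡0 = cong₂ _+ℤ_ (g≡0 0) (Σ<-zero n (g≡0 ∘ suc))

Σ<-cong : ∀ n {g h} → (∀ i → g i ≡ h i) → Σ< n g ≡ Σ< n h
Σ<-cong zero    g≡h = refl
Σ<-cong (suc n) g≡h = cong₂ _+ℤ_ (g≡h 0) (Σ<-cong n (g≡h ∘ suc))

Σ<-vanishing-tail : ∀ n {d g} → (∀ i → g (n + i) ≡ 0ℤ) → Σ< (n + d) g ≡ Σ< n g
Σ<-vanishing-tail zero    {d} g≡0 = Σ<-zero d g≡0
Σ<-vanishing-tail (suc n) {g = g} g≡0 = cong (g 0 +ℤ_) (Σ<-vanishing-tail n g≡0)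

⊛-Σ : ∀ f g m k → (f ⊛ g) m k ≡ Σ< (suc m) (λ a → Σ< (suc k) (λ b → f a b *ℤ g (m ∸ a) (k ∸ b)))
⊛-Σ f g m k = begin
  sumℤ (concat (map terms (upTo (suc m))))     ≡⟨ sumℤ-concat (map terms (upTo (suc m))) ⟩
  sumℤ (map sumℤ (map terms (upTo (suc m))))   ≡⟨ cong sumℤ (map-∘ {g = sumℤ} {f = terms} (upTo (suc m))) ⟨
  sumℤ (map (sumℤ ∘ terms) (upTo (suc m)))
    ≡⟨ cong sumℤ (map-cong (λ a → cong sumℤ (map-applyUpTo id (term a) (suc k))) (upTo (suc m))) ⟩
  sumℤ (map (λ a → Σ< (suc k) (term a)) (upTo (suc m)))
    ≡⟨ cong sumℤ (map-applyUpTo id (λ a → Σ< (suc k) (term a)) (suc m)) ⟩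
  Σ< (suc m) (λ a → Σ< (suc k) (term a))     ∎
  where
    term = λ a b → f a b *ℤ g (m ∸ a) (k ∸ b)
    terms = λ a → map (term a) (upTo (suc k))

row-convolution : ∀ B (c : ℕ → ℤ) → (∀ b → c (B + b) ≡ 0ℤ) → ∀ f k →
  Σ< (suc k) (λ b → c b *ℤ f (k ∸ b)) ≡ Σ< B (λ b → c b *ℤ t^ b f k)
row-convolution zero    c c≡0 f k       = Σ<-zero (suc k) λ b → cong (_*ℤ f (k ∸ b)) (c≡0 b)
row-convolution (suc B) c c≡0 f zero    =
  cong (c 0 *ℤ f 0 +ℤ_) (sym (Σ<-zero B λ b → ℤ.*-zeroʳ (c (suc b))))
row-convolution (suc B) c c≡0 f (suc k) =
  cong (c 0 *ℤ f (suc k) +ℤ_) (row-convolution B (c ∘ suc) c≡0 f k)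

⊛-expansion : ∀ B (c : PS) → (∀ a b → c a (B + b) ≡ 0ℤ) → ∀ Φ m k →
  (c ⊛ Φ) m k ≡ Σ< (suc m) (λ a → Σ< B (λ b → c a b *ℤ t^ b (Φ (m ∸ a)) k))
⊛-expansion B c c≡0 Φ m k =
  trans (⊛-Σ c Φ m k) (Σ<-cong (suc m) λ a → row-convolution B (c a) (c≡0 a) (Φ (m ∸ a)) k)

Den-degᵗ : ∀ a b → Den a (5 + b) ≡ 0ℤ
Den-degᵗ 0 b = refl
Den-degᵗ 1 b = refl
Den-degᵗ 2 b = refl
Den-degᵗ 3 b = refl
Den-degᵗ 4 b = refl
Den-degᵗ 5 b = refl
Den-degᵗ 6 b = refl
Den-degᵗ (suc (suc (suc (suc (suc (suc (suc a))))))) b = refl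

-- Skipping literal zero coefficients makes lincomb (denTerms X) compute to the
-- ten nonzero terms of Den, so that it can be matched definitionally below.
lincomb : List (ℤ × ℤ) → ℤ
lincomb []                = 0ℤ
lincomb ((+ 0 , _) ∷ cxs) = lincomb cxs
lincomb ((c , x) ∷ [])    = c *ℤ x
lincomb ((c , x) ∷ cxs)   = c *ℤ x +ℤ lincomb cxs

lincomb-sound : ∀ cxs → lincomb cxs ≡ sumℤ (map (uncurry _*ℤ_) cxs)
lincomb-sound []                             = refl
lincomb-sound ((+ 0 , x) ∷ cxs)              = trans (lincomb-sound cxs) (sym (ℤ.+-identityˡ _))
lincomb-sound ((+ suc n , x) ∷ [])           = sym (ℤ.+-identityʳ _)
lincomb-sound ((ℤ.-[1+ n ] , x) ∷ [])        = sym (ℤ.+-identityʳ _)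
lincomb-sound ((+ suc n , x) ∷ cx ∷ cxs)     = cong (+ suc n *ℤ x +ℤ_) (lincomb-sound (cx ∷ cxs))
lincomb-sound ((ℤ.-[1+ n ] , x) ∷ cx ∷ cxs)  = cong (ℤ.-[1+ n ] *ℤ x +ℤ_) (lincomb-sound (cx ∷ cxs))

denTerms : (ℕ → ℕ → ℤ) → List (ℤ × ℤ)
denTerms X = concat (applyUpTo (λ a → applyUpTo (λ b → Den a b , X a b) 5) 7)

Den-lincomb : ∀ X → Σ< 7 (λ a → Σ< 5 (λ b → Den a b *ℤ X a b)) ≡ lincomb (denTerms X)
Den-lincomb X = sym (begin
  lincomb (denTerms X)                                    ≡⟨ lincomb-sound (denTerms X) ⟩
  sumℤ (map (uncurry _*ℤ_) (denTerms X))                  ≡⟨ cong sumℤ (concat-map {f = uncurry _*ℤ_} table) ⟨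
  sumℤ (concat (map (map (uncurry _*ℤ_)) table))          ≡⟨ sumℤ-concat (map (map (uncurry _*ℤ_)) table) ⟩
  sumℤ (map sumℤ (map (map (uncurry _*ℤ_)) table))        ∎)
  where table = applyUpTo (λ a → applyUpTo (λ b → Den a b , X a b) 5) 7

-- p3² stands for t² P (c + 3), and likewise s for Lanes 2 and r for Lanes 1.
Den-annihilates :
  ∀ (p6 p5 p4¹ p3¹ p3² p2² p1² p1³ p0³ p0⁴ s3¹ s1² s0³ r2² r3¹ : ℤ) →
  p6  ≡ p3² +ℤ (p3¹ +ℤ (p3¹ +ℤ (s3¹ +ℤ p5))) →
  p4¹ ≡ p1³ +ℤ (p1² +ℤ (p1² +ℤ (s1² +ℤ p3¹))) →
  p3² ≡ p0⁴ +ℤ (p0³ +ℤ (p0³ +ℤ (s0³ +ℤ p2²))) →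
  s3¹ ≡ r2² +ℤ r3¹ →
  r2² ≡ s0³ +ℤ (p2² +ℤ p2²) →
  r3¹ ≡ s1² +ℤ (p3¹ +ℤ p3¹) →
  1ℤ *ℤ p6 +ℤ (-1ℤ *ℤ p5 +ℤ (-1ℤ *ℤ p4¹ +ℤ (- + 3 *ℤ p3¹ +ℤ (- + 2 *ℤ p3² +ℤ (-1ℤ *ℤ p2² +ℤ
    (+ 2 *ℤ p1² +ℤ (1ℤ *ℤ p1³ +ℤ (+ 2 *ℤ p0³ +ℤ 1ℤ *ℤ p0⁴)))))))) ≡ 0ℤ
Den-annihilates _ p5 _ p3¹ _ p2² p1² p1³ p0³ p0⁴ _ s1² s0³ _ _ refl refl refl refl refl refl =
  solve (p5 ∷ p3¹ ∷ p2² ∷ p1² ∷ p1³ ∷ p0³ ∷ p0⁴ ∷ s1² ∷ s0³ ∷ [])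

Den⊛F′-large : ∀ c k → (Den ⊛ F′) (8 + c) k ≡ 0ℤ
Den⊛F′-large c k = begin
  (Den ⊛ F′) (8 + c) k                          ≡⟨ ⊛-expansion 5 Den Den-degᵗ F′ (8 + c) k ⟩
  Σ< (7 + (2 + c)) rows                          ≡⟨ Σ<-vanishing-tail 7 {2 + c} {rows} (λ _ → refl) ⟩
  Σ< 7 rows                                      ≡⟨ Den-lincomb X ⟩
  lincomb (denTerms X)
    ≡⟨ Den-annihilates
         (P (6 + c) k) (P (5 + c) k) (t^ 1 (P (4 + c)) k) (t^ 1 (P (3 + c)) k) (t^ 2 (P (3 + c)) k)
         (t^ 2 (P (2 + c)) k) (t^ 2 (P (1 + c)) k) (t^ 3 (P (1 + c)) k) (t^ 3 (P c) k) (t^ 4 (P c) k)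
         (t^ 1 (Lanes 2 (3 + c)) k) (t^ 2 (Lanes 2 (1 + c)) k) (t^ 3 (Lanes 2 c) k)
         (t^ 2 (Lanes 1 (2 + c)) k) (t^ 1 (Lanes 1 (3 + c)) k)
         (P-rec 0 (3 + c) k) (P-rec 1 (1 + c) k) (P-rec 2 c k)
         (Lanes₂-rec 1 (2 + c) k) (Lanes₁-rec 2 c k) (Lanes₁-rec 1 (1 + c) k) ⟩
  0ℤ                                            ∎
  where
    X  = λ a b → t^ b (F′ (8 + c ∸ a)) k
    rows = λ a → Σ< 5 (λ b → Den a b *ℤ X a b)

⊛-congʳ : ∀ f {g h : PS} → (∀ m k → g m k ≡ h m k) → ∀ m k → (f ⊛ g) m k ≡ (f ⊛ h) m k
⊛-congʳ f g≡h m k = cong (sumℤ ∘ concat) (map-cong (λ a →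
  map-cong (λ b → cong (f a b *ℤ_) (g≡h (m ∸ a) (k ∸ b))) (upTo (suc k))) (upTo (suc m)))

Den⊛F′-initial : ∀ {m k} → m < 8 → k < 9 → (Den ⊛ F′) m k ≡ Num m k
Den⊛F′-initial m<8 k<9 = All.applyUpTo⁻ id 9 (All.applyUpTo⁻ id 8 table m<8) k<9
  where
    table = from-yes (all? (λ m → all? (λ k → (Den ⊛ F′) m k ℤ.≟ Num m k) (upTo 9)) (upTo 8))

-- At most four 3×3 squares fit into a 6×7 rectangle, so for m < 8 nothing survives beyond t⁸.
Den⊛F′-high-degree : ∀ {m} → m < 8 → ∀ k → (Den ⊛ F′) m (9 + k) ≡ Num m (9 + k)
Den⊛F′-high-degree {m} m<8 k =
  trans (⊛-expansion 5 Den Den-degᵗ F′ m (9 + k)) (All.applyUpTo⁻ id 8 table m<8 k)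
  where
    table : All (λ m → ∀ k → Σ< (suc m) (λ a → Σ< 5 (λ b → Den a b *ℤ t^ b (F′ (m ∸ a)) (9 + k))) ≡ Num m (9 + k))
                (upTo 8)
    table = (λ _ → refl) All.∷ (λ _ → refl) All.∷ (λ _ → refl) All.∷ (λ _ → refl) All.∷
            (λ _ → refl) All.∷ (λ _ → refl) All.∷ (λ _ → refl) All.∷ (λ _ → refl) All.∷ All.[]

Den⊛F′ : ∀ m k → (Den ⊛ F′) m k ≡ Num m k
Den⊛F′ m k with m <? 8 | k <? 9
... | yes m<8 | yes k<9 = Den⊛F′-initial m<8 k<9
... | yes m<8 | no  k≮9 = subst (λ k → (Den ⊛ F′) m k ≡ Num m k) (m+[n∸m]≡n (≮⇒≥ k≮9))
                                (Den⊛F′-high-degree m<8 (k ∸ 9))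
... | no  m≮8 | _       = subst (λ m → (Den ⊛ F′) m k ≡ Num m k) (m+[n∸m]≡n (≮⇒≥ m≮8))
                                (Den⊛F′-large (m ∸ 8) k)

mainTheorem10 : (m k : ℕ) → (Den ⊛ F) m k ≡ Num m k
mainTheorem10 m k = trans (⊛-congʳ Den F≡F′ m k) (Den⊛F′ m k)
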